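{- Let $p$ be a prime and let $V$ be the $\mathbb{Q}$-vector space with basis the formal symbols $D(i)$ for $i\in\mathbb{Z}/p\mathbb{Z}$ and $L(i,j)$ for $i\in(\mathbb{Z}/p\mathbb{Z})\setminus\{0\}$, $j\in\mathbb{Z}/p\mathbb{Z}$ (all indices read modulo $p$). Define the following elements of $V$: $$\mathrm{FDT}:=p\sum_{j=0}^{p-1}D(j)-D(0),$$ $$\mathrm{RDS}(i):=D(i)+L(i,0)-L(i,-i)\quad(1\le i<p),$$ $$\mathrm{FDS}(i,j):=D(i+j)+L(i,j)+L(j,i)-L(i,j-i)-L(j,i-j)\quad(1\le i,j<p).$$ Then in $V$ $$\mathrm{FDT}=\sum_{1\le i<p}\mathrm{FDS}(i,i)+2\sum_{1\le j<i<p}\mathrm{FDS}(i,j)+2\sum_{i=1}^{p-1}\mathrm{RDS}(i).$$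
   Context: Let $\mu=e^{2\pi\sqrt{ -1}/p}$. The symbols are meant to stand for $D(i)=\mathrm{Li}_2(\mu^i)=\sum_{k>0}\mu^{ik}/k^2$ and $L(i,j)=\mathrm{Li}_{1,1}(\mu^i,\mu^j)=\sum_{k_1>k_2>0}\mu^{ik_1+jk_2}/(k_1k_2)$; under this interpretation $\mathrm{FDT}=0$ is the distribution relation $\mathrm{Li}_2(1)=p\sum_{j=0}^{p-1}\mathrm{Li}_2(\mu^j)$, $\mathrm{FDS}(i,j)=0$ are the finite double shuffle relations and $\mathrm{RDS}(i)=0$ the regularized double shuffle relations in weight two. The identity asserted is an identity of formal linear combinations in $V$. -}

module Defs where

open import Data.Nat using (ℕ; zero; suc; _+_; _∸_; _%_; NonZero)
open import Data.Nat.Properties using (_≟_)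
open import Data.Fin using (Fin; toℕ)
open import Data.Integer using (+_)
open import Data.Rational using (ℚ; 0ℚ; 1ℚ; _/_) renaming (_+_ to _+ℚ_; _*_ to _*ℚ_; -_ to -ℚ_)
open import Data.List using (List; foldr; map; upTo; applyUpTo)
open import Data.Bool using (if_then_else_)
open import Relation.Nullary.Decidable using (⌊_⌋)
open import Relation.Binary.PropositionalEquality using (_≡_; _≢_)

-- The weight-two space V for a modulus p (p will be a prime; we only need p ≠ 0
-- here to reduce indices modulo p).
module Space (p : ℕ) ⦃ nz : NonZero p ⦄ where

  data Basis : Set where
    dB : Fin p → Basis
    lB : (i : Fin p) → toℕ i ≢ 0 → Fin p → Basis

  -- Elements of V: finitely supported (the basis is finite) ℚ-valued coefficient functions.
  V : Set
  V = Basis → ℚ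

  0V : V
  0V _ = 0ℚ

  _+V_ : V → V → V
  (u +V v) b = u b +ℚ v b

  -V_ : V → V
  (-V v) b = -ℚ (v b)

  _-V_ : V → V → V
  u -V v = u +V (-V v)

  _·V_ : ℚ → V → V
  (c ·V v) b = c *ℚ v b

  infixl 6 _+V_ _-V_
  infixr 7 _·V_

  _≈V_ : V → V → Set
  u ≈V v = ∀ b → u b ≡ v b

  ℕ→ℚ : ℕ → ℚ
  ℕ→ℚ n = (+ n) / 1

  -- Symbols with indices given as naturals, read modulo p.
  -- D a = basis vector D(a mod p).
  D : ℕ → V
  D a (dB i) = if ⌊ toℕ i ≟ a % p ⌋ then 1ℚ else 0ℚ
  D a (lB _ _ _) = 0ℚ

  -- L a b = basis vector L(a mod p, b mod p)  (only used with a mod p ≠ 0).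
  L : ℕ → ℕ → V
  L a b (dB _) = 0ℚ
  L a b (lB i _ j) = if ⌊ toℕ i ≟ a % p ⌋ then (if ⌊ toℕ j ≟ b % p ⌋ then 1ℚ else 0ℚ) else 0ℚ

  ΣV : List ℕ → (ℕ → V) → V
  ΣV xs f = foldr (λ x acc → f x +V acc) 0V xs

  range1 : ℕ → List ℕ
  range1 n = applyUpTo suc (n ∸ 1)

  FDT : V
  FDT = ℕ→ℚ p ·V ΣV (upTo p) D -V D 0

  -- RDS(i) := D(i) + L(i,0) - L(i,-i), with -i represented by p - i (1 ≤ i < p)
  RDS : ℕ → V
  RDS i = D i +V L i 0 -V L i (p ∸ i)

  -- FDS(i,j) := D(i+j) + L(i,j) + L(j,i) - L(i,j-i) - L(j,i-j)
  -- with j-i represented by j + p - i  (1 ≤ i, j < p)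
  FDS : ℕ → ℕ → V
  FDS i j = D (i + j) +V L i j +V L j i -V L i (j + p ∸ i) -V L j (i + p ∸ j)

  RHS : V
  RHS = ΣV (range1 p) (λ i → FDS i i)
        +V ℕ→ℚ 2 ·V ΣV (range1 p) (λ i → ΣV (range1 i) (λ j → FDS i j))
        +V ℕ→ℚ 2 ·V ΣV (range1 p) RDS

{-# OPTIONS --safe #-}
module Submission where

-- Fix a coordinate of V; then D and L become p-periodic functions of their last index,
-- and the identity is one between rational sums.  The weighted triangle of FDS(i,j) is
-- the sum of the full square 1 ≤ i, j < p of D(i+j) + 2(L(i,j) − L(i,j−i)), because FDS
-- is that expression symmetrised.  Summing a row over j covers a period with one point
-- missing: Σⱼ D(i+j) = ΣD − D(i), and Σⱼ (L(i,j) − L(i,j−i)) = L(i,−i) − L(i,0) = D(i) − RDS(i).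
-- Adding 2 Σᵢ RDS(i) leaves (p−1) ΣD + Σ_{i≠0} D(i) = p ΣD − D(0).

open import Defs
open import Data.Nat using (ℕ; zero; suc; _∸_; _<_; _≤_; NonZero)
import Data.Nat as ℕ
import Data.Nat.Properties as ℕ
open import Data.Nat.DivMod using ([m+n]%n≡m%n)
open import Data.Nat.Primality using (Prime; prime⇒nonZero)
import Data.Nat.Coprimality as Coprimality
import Data.Integer as ℤ
import Data.Integer.Properties as ℤ
open import Data.Rational using (ℚ; mkℚ; 0ℚ; 1ℚ; _/_; _+_; _-_; _*_)
open import Data.Rational.Properties using (normalize-coprime; /-cong; +-0-abelianGroup)
open import Data.Rational.Solver using (module +-*-Solver)
open import Algebra.Bundles using (AbelianGroup)
open import Algebra.Properties.Group (AbelianGroup.group +-0-abelianGroup) using (∙-cancelʳ)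
open import Data.Fin using (toℕ)
open import Data.List using (applyUpTo)
open import Data.Empty using (⊥-elim)
open import Data.Bool using (if_then_else_)
open import Relation.Nullary.Decidable using (⌊_⌋)
open import Relation.Binary.PropositionalEquality
open ≡-Reasoning
open +-*-Solver

fromℕ : ℕ → ℚ
fromℕ n = (ℤ.+ n) / 1

fromℕ-suc : ∀ n → fromℕ (suc n) ≡ 1ℚ + fromℕ n
fromℕ-suc n = begin
  fromℕ (suc n)                       ≡⟨ /-cong (cong (ℤ._+_ (ℤ.+ 1)) (sym (ℤ.*-identityʳ (ℤ.+ n)))) refl ⟩
  1ℚ + mkℚ (ℤ.+ n) 0 (coprimeTo1 n)   ≡⟨ cong (1ℚ +_) (sym (normalize-coprime (coprimeTo1 n))) ⟩
  1ℚ + fromℕ n                        ∎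
  where
  coprimeTo1 : ∀ n → Coprimality.Coprime n 1
  coprimeTo1 n = Coprimality.sym (Coprimality.1-coprimeTo n)

m+n∸o≡n∸o+m : ∀ m {n o} → o ≤ n → m ℕ.+ n ∸ o ≡ (n ∸ o) ℕ.+ m
m+n∸o≡n∸o+m m {n} {o} o≤n = trans (ℕ.+-∸-assoc m o≤n) (ℕ.+-comm m (n ∸ o))

∑ : ℕ → (ℕ → ℚ) → ℚ
∑ zero    f = 0ℚ
∑ (suc m) f = ∑ m f + f m

∑-cong : ∀ m {f g : ℕ → ℚ} → (∀ k → k < m → f k ≡ g k) → ∑ m f ≡ ∑ m g
∑-cong zero    eq = refl
∑-cong (suc m) eq = cong₂ _+_ (∑-cong m λ k k<m → eq k (ℕ.m<n⇒m<1+n k<m)) (eq m ℕ.≤-refl)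

∑-distrib-+ : ∀ m (f g : ℕ → ℚ) → ∑ m (λ k → f k + g k) ≡ ∑ m f + ∑ m g
∑-distrib-+ zero    f g = refl
∑-distrib-+ (suc m) f g = begin
  ∑ m (λ k → f k + g k) + (f m + g m) ≡⟨ cong (_+ (f m + g m)) (∑-distrib-+ m f g) ⟩
  (∑ m f + ∑ m g) + (f m + g m)       ≡⟨ solve 4 (λ a b c d → (a :+ b) :+ (c :+ d) := (a :+ c) :+ (b :+ d))
                                                 refl (∑ m f) (∑ m g) (f m) (g m) ⟩
  (∑ m f + f m) + (∑ m g + g m)       ∎

∑-distrib-- : ∀ m (f g : ℕ → ℚ) → ∑ m (λ k → f k - g k) ≡ ∑ m f - ∑ m g
∑-distrib-- zero    f g = refl
∑-distrib-- (suc m) f g = begin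
  ∑ m (λ k → f k - g k) + (f m - g m) ≡⟨ cong (_+ (f m - g m)) (∑-distrib-- m f g) ⟩
  (∑ m f - ∑ m g) + (f m - g m)       ≡⟨ solve 4 (λ a b c d → (a :- b) :+ (c :- d) := (a :+ c) :- (b :+ d))
                                                 refl (∑ m f) (∑ m g) (f m) (g m) ⟩
  (∑ m f + f m) - (∑ m g + g m)       ∎

∑-*-distribˡ : ∀ m c (f : ℕ → ℚ) → c * ∑ m f ≡ ∑ m (λ k → c * f k)
∑-*-distribˡ zero    c f = solve 1 (λ c → c :* con 0ℚ := con 0ℚ) refl c
∑-*-distribˡ (suc m) c f = begin
  c * (∑ m f + f m)           ≡⟨ solve 3 (λ c s x → c :* (s :+ x) := c :* s :+ c :* x) refl c (∑ m f) (f m) ⟩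
  c * ∑ m f + c * f m         ≡⟨ cong (_+ c * f m) (∑-*-distribˡ m c f) ⟩
  ∑ m (λ k → c * f k) + c * f m ∎

∑-const : ∀ m c → ∑ m (λ _ → c) ≡ fromℕ m * c
∑-const zero    c = solve 1 (λ c → con 0ℚ := con 0ℚ :* c) refl c
∑-const (suc m) c = begin
  ∑ m (λ _ → c) + c         ≡⟨ cong (_+ c) (∑-const m c) ⟩
  fromℕ m * c + c           ≡⟨ solve 2 (λ a c → a :* c :+ c := (con 1ℚ :+ a) :* c) refl (fromℕ m) c ⟩
  (1ℚ + fromℕ m) * c        ≡⟨ cong (_* c) (sym (fromℕ-suc m)) ⟩
  fromℕ (suc m) * c         ∎

∑-first : ∀ m (f : ℕ → ℚ) → ∑ (suc m) f ≡ f 0 + ∑ m (λ k → f (suc k))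
∑-first zero    f = solve 1 (λ a → con 0ℚ :+ a := a :+ con 0ℚ) refl (f 0)
∑-first (suc m) f = begin
  ∑ (suc m) f + f (suc m)                     ≡⟨ cong (_+ f (suc m)) (∑-first m f) ⟩
  (f 0 + ∑ m (λ k → f (suc k))) + f (suc m)   ≡⟨ solve 3 (λ a b c → (a :+ b) :+ c := a :+ (b :+ c))
                                                         refl (f 0) (∑ m (λ k → f (suc k))) (f (suc m)) ⟩
  f 0 + (∑ m (λ k → f (suc k)) + f (suc m))   ∎

∑-rotate : ∀ m (f : ℕ → ℚ) → ∑ m (λ k → f (suc k)) + f 0 ≡ ∑ m f + f m
∑-rotate zero    f = refl
∑-rotate (suc m) f = begin
  (∑ m (λ k → f (suc k)) + f (suc m)) + f 0   ≡⟨ solve 3 (λ a c b → (a :+ c) :+ b := (a :+ b) :+ c)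
                                                         refl (∑ m (λ k → f (suc k))) (f (suc m)) (f 0) ⟩
  (∑ m (λ k → f (suc k)) + f 0) + f (suc m)   ≡⟨ cong (_+ f (suc m)) (∑-rotate m f) ⟩
  (∑ m f + f m) + f (suc m)                   ∎

∑-periodic-shift : ∀ m (f : ℕ → ℚ) → (∀ x → f (x ℕ.+ m) ≡ f x) →
                   ∀ a → ∑ m (λ j → f (a ℕ.+ j)) ≡ ∑ m f
∑-periodic-shift m f periodic zero    = refl
∑-periodic-shift m f periodic (suc a) = begin
  ∑ m (λ j → f (suc a ℕ.+ j)) ≡⟨ ∑-cong m (λ j _ → cong f (sym (ℕ.+-suc a j))) ⟩
  ∑ m (λ j → g (suc j))       ≡⟨ ∙-cancelʳ (f a) _ _ rotated ⟩
  ∑ m g                       ≡⟨ ∑-periodic-shift m f periodic a ⟩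
  ∑ m f                       ∎
  where
  g : ℕ → ℚ
  g j = f (a ℕ.+ j)
  rotated : ∑ m (λ j → g (suc j)) + f a ≡ ∑ m g + f a
  rotated = begin
    ∑ m (λ j → g (suc j)) + f a ≡⟨ cong (λ x → ∑ m (λ j → g (suc j)) + f x) (sym (ℕ.+-identityʳ a)) ⟩
    ∑ m (λ j → g (suc j)) + g 0 ≡⟨ ∑-rotate m g ⟩
    ∑ m g + g m                 ≡⟨ cong (∑ m g +_) (periodic a) ⟩
    ∑ m g + f a                 ∎

∑-periodic-punctured : ∀ n (f : ℕ → ℚ) → (∀ x → f (x ℕ.+ suc n) ≡ f x) →
                       ∀ a → ∑ n (λ j → f (a ℕ.+ suc j)) ≡ ∑ (suc n) f - f a
∑-periodic-punctured n f periodic a = begin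
  ∑ n (λ j → f (a ℕ.+ suc j))                         ≡⟨ solve 2 (λ s x → s := (x :+ s) :- x) refl _ (f a) ⟩
  (f a + ∑ n (λ j → f (a ℕ.+ suc j))) - f a           ≡⟨ cong (λ x → (f x + ∑ n (λ j → f (a ℕ.+ suc j))) - f a)
                                                               (sym (ℕ.+-identityʳ a)) ⟩
  (f (a ℕ.+ 0) + ∑ n (λ j → f (a ℕ.+ suc j))) - f a   ≡⟨ sym (cong (_- f a) (∑-first n (λ j → f (a ℕ.+ j)))) ⟩
  ∑ (suc n) (λ j → f (a ℕ.+ j)) - f a                 ≡⟨ cong (_- f a) (∑-periodic-shift (suc n) f periodic a) ⟩
  ∑ (suc n) f - f a                                   ∎

∑-square : ∀ m (H : ℕ → ℕ → ℚ) →
           ∑ m (λ i → ∑ m (H i)) ≡ ∑ m (λ i → H i i) + ∑ m (λ i → ∑ i (λ j → H i j + H j i))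
∑-square zero    H = refl
∑-square (suc m) H = begin
  ∑ m (λ i → ∑ m (H i) + H i m) + (row + H m m)    ≡⟨ cong (_+ (row + H m m)) (∑-distrib-+ m (λ i → ∑ m (H i)) (λ i → H i m)) ⟩
  (∑ m (λ i → ∑ m (H i)) + col) + (row + H m m)    ≡⟨ cong (λ x → (x + col) + (row + H m m)) (∑-square m H) ⟩
  ((diag + tri) + col) + (row + H m m)             ≡⟨ solve 5 (λ a b c d e → ((a :+ b) :+ c) :+ (d :+ e) := (a :+ e) :+ (b :+ (d :+ c)))
                                                              refl diag tri col row (H m m) ⟩
  (diag + H m m) + (tri + (row + col))             ≡⟨ cong (λ x → (diag + H m m) + (tri + x)) (sym (∑-distrib-+ m (H m) (λ j → H j m))) ⟩
  (diag + H m m) + (tri + ∑ m (λ j → H m j + H j m)) ∎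
  where
  diag tri row col : ℚ
  diag = ∑ m (λ i → H i i)
  tri  = ∑ m (λ i → ∑ i (λ j → H i j + H j i))
  row  = ∑ m (H m)
  col  = ∑ m (λ i → H i m)

module Coordinates (n : ℕ) where
  open Space (suc n)

  D-periodic : ∀ b x → D (x ℕ.+ suc n) b ≡ D x b
  D-periodic (dB i)      x = cong (λ r → if ⌊ toℕ i ℕ.≟ r ⌋ then 1ℚ else 0ℚ) ([m+n]%n≡m%n x (suc n))
  D-periodic (lB _ _ _) x = refl

  L-periodic : ∀ b i y → L i (y ℕ.+ suc n) b ≡ L i y b
  L-periodic (dB _)      i y = refl
  L-periodic (lB a _ c) i y =
    cong (λ r → if ⌊ toℕ a ℕ.≟ i ℕ.% suc n ⌋ then (if ⌊ toℕ c ℕ.≟ r ⌋ then 1ℚ else 0ℚ) else 0ℚ)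
         ([m+n]%n≡m%n y (suc n))

  ΣV-coordinate : ∀ b m (g : ℕ → ℕ) (F : ℕ → V) → ΣV (applyUpTo g m) F b ≡ ∑ m (λ k → F (g k) b)
  ΣV-coordinate b zero    g F = refl
  ΣV-coordinate b (suc m) g F = begin
    F (g 0) b + ΣV (applyUpTo (λ k → g (suc k)) m) F b ≡⟨ cong (F (g 0) b +_) (ΣV-coordinate b m (λ k → g (suc k)) F) ⟩
    F (g 0) b + ∑ m (λ k → F (g (suc k)) b)            ≡⟨ sym (∑-first m (λ k → F (g k) b)) ⟩
    ∑ (suc m) (λ k → F (g k) b)                         ∎

  module _ (b : Basis) where

    d : ℕ → ℚ
    d x = D x b

    l : ℕ → ℕ → ℚ
    l i y = L i y b

    ∑d : ℚ
    ∑d = ∑ (suc n) d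

    two : ℚ
    two = fromℕ 2

    G : ℕ → ℕ → ℚ
    G i j = l i j - l i (j ℕ.+ suc n ∸ i)

    FDS-split : ∀ i j → FDS i j b ≡ d (i ℕ.+ j) + G i j + G j i
    FDS-split i j = solve 5 (λ e a b c f → (((e :+ a) :+ b) :- c) :- f := (e :+ (a :- c)) :+ (b :- f))
                            refl (d (i ℕ.+ j)) (l i j) (l j i) (l i (j ℕ.+ suc n ∸ i)) (l j (i ℕ.+ suc n ∸ j))

    -- H k j is H(k+1, j+1) of the square 1 ≤ i, j < p, so sums ∑ n over k cover i = 1 … p−1.
    H : ℕ → ℕ → ℚ
    H k j = d (suc k ℕ.+ suc j) + two * G (suc k) (suc j)

    H-diagonal : ∀ k → H k k ≡ FDS (suc k) (suc k) b
    H-diagonal k = begin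
      e + two * g  ≡⟨ solve 2 (λ e g → e :+ con two :* g := e :+ g :+ g) refl e g ⟩
      e + g + g    ≡⟨ sym (FDS-split (suc k) (suc k)) ⟩
      FDS (suc k) (suc k) b ∎
      where
      e g : ℚ
      e = d (suc k ℕ.+ suc k)
      g = G (suc k) (suc k)

    H-symmetrised : ∀ k j → H k j + H j k ≡ two * FDS (suc k) (suc j) b
    H-symmetrised k j = begin
      (e + two * g) + (d (suc j ℕ.+ suc k) + two * g′) ≡⟨ cong (λ x → (e + two * g) + (d x + two * g′)) (ℕ.+-comm (suc j) (suc k)) ⟩
      (e + two * g) + (e + two * g′)                  ≡⟨ solve 3 (λ e g g′ → (e :+ con two :* g) :+ (e :+ con two :* g′)
                                                                    := con two :* (e :+ g :+ g′)) refl e g g′ ⟩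
      two * (e + g + g′)                              ≡⟨ cong (two *_) (sym (FDS-split (suc k) (suc j))) ⟩
      two * FDS (suc k) (suc j) b                     ∎
      where
      e g g′ : ℚ
      e  = d (suc k ℕ.+ suc j)
      g  = G (suc k) (suc j)
      g′ = G (suc j) (suc k)

    row-D : ∀ k → ∑ n (λ j → d (suc k ℕ.+ suc j)) ≡ ∑d - d (suc k)
    row-D k = ∑-periodic-punctured n d (D-periodic b) (suc k)

    row-G : ∀ k → k < n → ∑ n (λ j → G (suc k) (suc j)) ≡ d (suc k) - RDS (suc k) b
    row-G k k<n = begin
      ∑ n (λ j → G i (suc j))
        ≡⟨ ∑-distrib-- n (λ j → l i (suc j)) (λ j → l i (suc j ℕ.+ suc n ∸ i)) ⟩
      ∑ n (λ j → l i (suc j)) - ∑ n (λ j → l i (suc j ℕ.+ suc n ∸ i))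
        ≡⟨ cong (_-_ (∑ n (λ j → l i (suc j)))) (∑-cong n λ j _ → cong (l i) (m+n∸o≡n∸o+m (suc j) (ℕ.m≤n⇒m≤1+n k<n))) ⟩
      ∑ n (λ j → l i (suc j)) - ∑ n (λ j → l i ((n ∸ k) ℕ.+ suc j))
        ≡⟨ cong₂ _-_ (punctured 0) (punctured (n ∸ k)) ⟩
      (∑ (suc n) (l i) - l i 0) - (∑ (suc n) (l i) - l i (n ∸ k))
        ≡⟨ solve 4 (λ s x y e → (s :- x) :- (s :- y) := e :- ((e :+ x) :- y)) refl (∑ (suc n) (l i)) (l i 0) (l i (n ∸ k)) (d i) ⟩
      d i - RDS i b
        ∎
      where
      i : ℕ
      i = suc k
      punctured : ∀ a → ∑ n (λ j → l i (a ℕ.+ suc j)) ≡ ∑ (suc n) (l i) - l i a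
      punctured = ∑-periodic-punctured n (l i) (L-periodic b i)

    row-H : ∀ k → k < n → ∑ n (H k) + two * RDS (suc k) b ≡ ∑d + d (suc k)
    row-H k k<n = begin
      ∑ n (H k) + two * r
        ≡⟨ cong (_+ two * r) (∑-distrib-+ n (λ j → d (suc k ℕ.+ suc j)) (λ j → two * G (suc k) (suc j))) ⟩
      (∑ n (λ j → d (suc k ℕ.+ suc j)) + ∑ n (λ j → two * G (suc k) (suc j))) + two * r
        ≡⟨ cong (λ x → (∑ n (λ j → d (suc k ℕ.+ suc j)) + x) + two * r) (sym (∑-*-distribˡ n two (λ j → G (suc k) (suc j)))) ⟩
      (∑ n (λ j → d (suc k ℕ.+ suc j)) + two * ∑ n (λ j → G (suc k) (suc j))) + two * r
        ≡⟨ cong₂ (λ x y → (x + two * y) + two * r) (row-D k) (row-G k k<n) ⟩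
      ((∑d - d (suc k)) + two * (d (suc k) - r)) + two * r
        ≡⟨ solve 3 (λ s e r → ((s :- e) :+ con two :* (e :- r)) :+ con two :* r := s :+ e) refl ∑d (d (suc k)) r ⟩
      ∑d + d (suc k)
        ∎
      where
      r : ℚ
      r = RDS (suc k) b

    ∑RDS : ℚ
    ∑RDS = ∑ n (λ k → RDS (suc k) b)

    ∑d⁺ : ℚ
    ∑d⁺ = ∑ n (λ k → d (suc k))

    FDT-coordinate : FDT b ≡ fromℕ n * ∑d + ∑d⁺
    FDT-coordinate = begin
      FDT b                                  ≡⟨ cong (λ x → fromℕ (suc n) * x - d 0) (ΣV-coordinate b (suc n) (λ x → x) D) ⟩
      fromℕ (suc n) * ∑d - d 0               ≡⟨ cong₂ (λ x y → x * y - d 0) (fromℕ-suc n) (∑-first n d) ⟩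
      (1ℚ + fromℕ n) * (d 0 + ∑d⁺) - d 0     ≡⟨ solve 3 (λ a x y → (con 1ℚ :+ a) :* (x :+ y) :- x := a :* (x :+ y) :+ y)
                                                        refl (fromℕ n) (d 0) ∑d⁺ ⟩
      fromℕ n * (d 0 + ∑d⁺) + ∑d⁺            ≡⟨ cong (λ x → fromℕ n * x + ∑d⁺) (sym (∑-first n d)) ⟩
      fromℕ n * ∑d + ∑d⁺                     ∎

    RHS-coordinate : RHS b ≡ (∑ n (λ k → FDS (suc k) (suc k) b) + two * ∑ n (λ k → ∑ k (λ j → FDS (suc k) (suc j) b)))
                             + two * ∑RDS
    RHS-coordinate = cong₂ (λ x y → x + two * y)
      (cong₂ (λ x y → x + two * y)
        (ΣV-coordinate b n suc (λ i → FDS i i))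
        (trans (ΣV-coordinate b n suc (λ i → ΣV (range1 i) (FDS i)))
               (∑-cong n λ k _ → ΣV-coordinate b k suc (FDS (suc k)))))
      (ΣV-coordinate b n suc RDS)

    triangle≡square : ∑ n (λ k → FDS (suc k) (suc k) b) + two * ∑ n (λ k → ∑ k (λ j → FDS (suc k) (suc j) b))
                      ≡ ∑ n (λ k → ∑ n (H k))
    triangle≡square = begin
      ∑ n (λ k → FDS (suc k) (suc k) b) + two * ∑ n (λ k → ∑ k (λ j → FDS (suc k) (suc j) b))
        ≡⟨ cong₂ _+_ (∑-cong n λ k _ → sym (H-diagonal k)) (∑-*-distribˡ n two _) ⟩
      ∑ n (λ k → H k k) + ∑ n (λ k → two * ∑ k (λ j → FDS (suc k) (suc j) b))
        ≡⟨ cong (∑ n (λ k → H k k) +_) (∑-cong n λ k _ →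
             trans (∑-*-distribˡ k two _) (∑-cong k λ j _ → sym (H-symmetrised k j))) ⟩
      ∑ n (λ k → H k k) + ∑ n (λ k → ∑ k (λ j → H k j + H j k))
        ≡⟨ sym (∑-square n H) ⟩
      ∑ n (λ k → ∑ n (H k))
        ∎

    square+RDS : ∑ n (λ k → ∑ n (H k)) + two * ∑RDS ≡ fromℕ n * ∑d + ∑d⁺
    square+RDS = begin
      ∑ n (λ k → ∑ n (H k)) + two * ∑RDS
        ≡⟨ cong (∑ n (λ k → ∑ n (H k)) +_) (∑-*-distribˡ n two (λ k → RDS (suc k) b)) ⟩
      ∑ n (λ k → ∑ n (H k)) + ∑ n (λ k → two * RDS (suc k) b)
        ≡⟨ sym (∑-distrib-+ n (λ k → ∑ n (H k)) (λ k → two * RDS (suc k) b)) ⟩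
      ∑ n (λ k → ∑ n (H k) + two * RDS (suc k) b)
        ≡⟨ ∑-cong n row-H ⟩
      ∑ n (λ k → ∑d + d (suc k))
        ≡⟨ ∑-distrib-+ n (λ _ → ∑d) (λ k → d (suc k)) ⟩
      ∑ n (λ _ → ∑d) + ∑d⁺
        ≡⟨ cong (_+ ∑d⁺) (∑-const n ∑d) ⟩
      fromℕ n * ∑d + ∑d⁺
        ∎

    FDT≡RHS : FDT b ≡ RHS b
    FDT≡RHS = begin
      FDT b                                 ≡⟨ FDT-coordinate ⟩
      fromℕ n * ∑d + ∑d⁺                    ≡⟨ sym square+RDS ⟩
      ∑ n (λ k → ∑ n (H k)) + two * ∑RDS    ≡⟨ cong (_+ two * ∑RDS) (sym triangle≡square) ⟩
      _                                     ≡⟨ sym RHS-coordinate ⟩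
      RHS b                                 ∎

mainTheorem1 : (p : ℕ) (pp : Prime p) →
    let open Space p ⦃ prime⇒nonZero pp ⦄ in FDT ≈V RHS
mainTheorem1 zero    pp = ⊥-elim (NonZero.nonZero (prime⇒nonZero pp))
mainTheorem1 (suc n) pp = Coordinates.FDT≡RHS n
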